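{- Let $G$ be a connected graph of order at least $3$ whose girth satisfies $g(G)\ge 5$ (with $g(G)=\infty$ if $G$ is a forest). Then every outer mutual-visibility set of $G$ is an independent set.
   Context: For a connected graph $G$ and $X\subseteq V(G)$, two vertices $x,y\in V(G)$ are $X$-visible if there is a shortest $x,y$-path whose internal vertices do not belong to $X$. A set $X$ is an outer mutual-visibility set if every two vertices $x,y\in X$ are $X$-visible and every $x\in X$ and $y\in V(G)\setminus X$ are $X$-visible. The girth $g(G)$ is the length of a shortest cycle of $G$. -}

module Defs where

open import Data.Nat using (ℕ; zero; suc; _≤_)
open import Data.Fin using (Fin; toℕ)
open import Data.Product using (Σ; _×_; ∃)
open import Data.Unit using (⊤)
open import Data.Empty using (⊥)
open import Relation.Nullary using (¬_)
open import Relation.Binary.PropositionalEquality using (_≡_)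
open import Function.Definitions using (Injective)

record Graph (n : ℕ) : Set₁ where
  field
    Adj    : Fin n → Fin n → Set
    sym    : ∀ {x y} → Adj x y → Adj y x
    irrefl : ∀ {x} → ¬ Adj x x
open Graph public

data Walk {n : ℕ} (G : Graph n) : Fin n → Fin n → ℕ → Set where
  nil  : ∀ {x} → Walk G x x 0
  cons : ∀ {x y z k} → Adj G x y → Walk G y z k → Walk G x z (suc k)

AllButLast : ∀ {n} {G : Graph n} → (Fin n → Set) → ∀ {x y k} → Walk G x y k → Set
AllButLast P nil = ⊤
AllButLast P (cons {x = x} _ w) = P x × AllButLast P w

AllInternal : ∀ {n} {G : Graph n} → (Fin n → Set) → ∀ {x y k} → Walk G x y k → Set
AllInternal P nil = ⊤
AllInternal P (cons _ w) = AllButLast P w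

IsShortest : ∀ {n} (G : Graph n) {x y k} → Walk G x y k → Set
IsShortest G {x} {y} {k} _ = ∀ {k'} → Walk G x y k' → k ≤ k'

Connected : ∀ {n} → Graph n → Set
Connected G = ∀ x y → ∃ λ k → Walk G x y k

record Cycle {n : ℕ} (G : Graph n) (ℓ : ℕ) : Set where
  field
    len≥3  : 3 ≤ ℓ
    vert   : Fin ℓ → Fin n
    inj    : Injective _≡_ _≡_ vert
    consec : ∀ i j → suc (toℕ i) ≡ toℕ j → Adj G (vert i) (vert j)
    close  : ∀ i j → suc (toℕ i) ≡ ℓ → toℕ j ≡ 0 → Adj G (vert i) (vert j)

-- g(G) ≥ m  (vacuous for forests, where g(G) = ∞)
GirthAtLeast : ∀ {n} → Graph n → ℕ → Set
GirthAtLeast G m = ∀ {ℓ} → Cycle G ℓ → m ≤ ℓ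

Subset : ℕ → Set₁
Subset n = Fin n → Set

Visible : ∀ {n} (G : Graph n) → Subset n → Fin n → Fin n → Set
Visible G X x y =
  Σ ℕ λ k → Σ (Walk G x y k) λ w → IsShortest G w × AllInternal (λ v → ¬ X v) w

IsOuterMutualVisibility : ∀ {n} (G : Graph n) → Subset n → Set
IsOuterMutualVisibility G X =
  (∀ x y → X x → X y → Visible G X x y) ×
  (∀ x y → X x → ¬ X y → Visible G X x y)

IsIndependent : ∀ {n} (G : Graph n) → Subset n → Set
IsIndependent G X = ∀ x y → X x → X y → ¬ Adj G x y

-- Suppose x, y ∈ X are adjacent. Without triangles and 4-cycles, two
-- vertices at distance 2 have a unique common neighbour, so for every
-- neighbour w ≠ x of y the only shortest x,w-path is x y w, whose internal
-- vertex y lies in X: x and w are not X-visible, whether or not w ∈ X.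
-- Hence x and y have no neighbours besides each other, so {x, y} is a
-- component of G, which is impossible in a connected graph of order ≥ 3.
module Submission where

open import Defs
open import Data.Nat using (ℕ; suc; _+_; _≤_; s≤s; z≤n)
open import Data.Nat.Properties using (suc-injective)
open import Data.Fin using (Fin; toℕ; inject₁; fromℕ; _≟_)
  renaming (zero to fzero; suc to fsuc)
open import Data.Fin.Properties using (toℕ-injective; toℕ-inject₁; toℕ-fromℕ)
open import Data.Vec using (Vec; []; _∷_; lookup)
open import Data.Vec.Relation.Unary.All using ([]; _∷_)
open import Data.Vec.Relation.Unary.AllPairs using ([]; _∷_)
open import Data.Vec.Relation.Unary.Unique.Propositional using (Unique)
open import Data.Vec.Relation.Unary.Unique.Propositional.Properties
  using (lookup-injective)
open import Data.Product using (_×_; _,_; ∃; ∃₂; proj₂)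
open import Data.Sum using (inj₁; inj₂; [_,_])
open import Data.Empty using (⊥-elim)
open import Data.Unit using (tt)
open import Relation.Nullary using (¬_; yes; no)
open import Relation.Nullary.Decidable using (_⊎-dec_; ¬¬-excluded-middle)
open import Relation.Unary using (Pred; Decidable)
open import Relation.Binary.PropositionalEquality
  using (_≡_; _≢_; ≢-sym; refl; trans; subst) renaming (sym to ≡-sym)

third-vertex : ∀ {n} → 3 ≤ n → (x y : Fin n) → ∃ λ z → z ≢ x × z ≢ y
third-vertex (s≤s (s≤s (s≤s _))) = pick
  where
  pick : ∀ {m} (x y : Fin (suc (suc (suc m)))) → ∃ λ z → z ≢ x × z ≢ y
  pick fzero           fzero           = fsuc fzero , (λ ()) , (λ ())
  pick fzero           (fsuc fzero)    = fsuc (fsuc fzero) , (λ ()) , (λ ())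
  pick fzero           (fsuc (fsuc _)) = fsuc fzero , (λ ()) , (λ ())
  pick (fsuc fzero)    fzero           = fsuc (fsuc fzero) , (λ ()) , (λ ())
  pick (fsuc (fsuc _)) fzero           = fsuc fzero , (λ ()) , (λ ())
  pick (fsuc _)        (fsuc _)        = fzero , (λ ()) , (λ ())

module _ {n : ℕ} (G : Graph n) where

  adj⇒≢ : ∀ {x y} → Adj G x y → x ≢ y
  adj⇒≢ xy refl = irrefl G xy

  walk-exits : ∀ {p} {P : Pred (Fin n) p} → Decidable P → ∀ {a z k} →
               Walk G a z k → P a → ¬ P z → ∃₂ λ u w → P u × ¬ P w × Adj G u w
  walk-exits P? nil Pa ¬Pz = ⊥-elim (¬Pz Pa)
  walk-exits P? (cons {x = a} {y = b} ab w) Pa ¬Pz with P? b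
  ... | yes Pb = walk-exits P? w Pb ¬Pz
  ... | no ¬Pb = a , b , Pa , ¬Pb , ab

  cycle : ∀ {k} (vs : Vec (Fin n) (3 + k)) → Unique vs →
          (∀ i → Adj G (lookup vs (inject₁ i)) (lookup vs (fsuc i))) →
          Adj G (lookup vs (fromℕ (2 + k))) (lookup vs fzero) →
          Cycle G (3 + k)
  cycle {k} vs distinct step last = record
    { len≥3  = s≤s (s≤s (s≤s z≤n))
    ; vert   = lookup vs
    ; inj    = λ {i} {j} → lookup-injective distinct i j
    ; consec = consec
    ; close  = close
    }
    where
    consec : ∀ i j → suc (toℕ i) ≡ toℕ j → Adj G (lookup vs i) (lookup vs j)
    consec i (fsuc j) i+1≡j+1 = subst (λ i′ → Adj G (lookup vs i′) (lookup vs (fsuc j)))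
      (≡-sym (toℕ-injective (trans (suc-injective i+1≡j+1) (≡-sym (toℕ-inject₁ j)))))
      (step j)
    close : ∀ i j → suc (toℕ i) ≡ 3 + k → toℕ j ≡ 0 → Adj G (lookup vs i) (lookup vs j)
    close i fzero i+1≡ℓ _ = subst (λ i′ → Adj G (lookup vs i′) (lookup vs fzero))
      (≡-sym (toℕ-injective (trans (suc-injective i+1≡ℓ) (≡-sym (toℕ-fromℕ (2 + k))))))
      last

  triangle : ∀ {x y z} → Adj G x y → Adj G y z → Adj G z x → Cycle G 3
  triangle xy yz zx = cycle (_ ∷ _ ∷ _ ∷ [])
    ((adj⇒≢ xy ∷ ≢-sym (adj⇒≢ zx) ∷ []) ∷ (adj⇒≢ yz ∷ []) ∷ [] ∷ [])
    (λ { fzero → xy ; (fsuc fzero) → yz })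
    zx

  square : ∀ {a b c d} → Adj G a b → Adj G b c → Adj G c d → Adj G d a →
           a ≢ c → b ≢ d → Cycle G 4
  square ab bc cd da a≢c b≢d = cycle (_ ∷ _ ∷ _ ∷ _ ∷ [])
    ((adj⇒≢ ab ∷ a≢c ∷ ≢-sym (adj⇒≢ da) ∷ []) ∷
     (adj⇒≢ bc ∷ b≢d ∷ []) ∷ (adj⇒≢ cd ∷ []) ∷ [] ∷ [])
    (λ { fzero → ab ; (fsuc fzero) → bc ; (fsuc (fsuc fzero)) → cd })
    da

  module _ (girth≥5 : GirthAtLeast G 5) where

    no-triangle : ∀ {x y z} → Adj G x y → Adj G y z → ¬ Adj G z x
    no-triangle xy yz zx with girth≥5 (triangle xy yz zx)
    ... | s≤s (s≤s (s≤s ()))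

    common-neighbour-unique : ∀ {x y u w} → x ≢ w → Adj G x y → Adj G y w →
                              Adj G x u → Adj G u w → u ≡ y
    common-neighbour-unique {y = y} {u} x≢w xy yw xu uw with u ≟ y
    ... | yes u≡y = u≡y
    ... | no u≢y with girth≥5 (square xu uw (sym G yw) (sym G xy) x≢w u≢y)
    ...   | s≤s (s≤s (s≤s (s≤s ())))

    middle∈X⇒¬Visible : (X : Subset n) → ∀ {x y w} → X y →
                        Adj G x y → Adj G y w → w ≢ x → ¬ Visible G X x w
    middle∈X⇒¬Visible X Xy xy yw w≢x (_ , nil , _) = w≢x refl
    middle∈X⇒¬Visible X Xy xy yw w≢x (_ , cons xw nil , _) =
      no-triangle xy yw (sym G xw)
    middle∈X⇒¬Visible X Xy xy yw w≢x (_ , cons xu (cons uw nil) , _ , ¬Xu , tt) =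
      ¬Xu (subst X (≡-sym (common-neighbour-unique (≢-sym w≢x) xy yw xu uw)) Xy)
    middle∈X⇒¬Visible X Xy xy yw w≢x (_ , cons _ (cons _ (cons _ _)) , shortest , _)
      with shortest (cons xy (cons yw nil))
    ... | s≤s (s≤s ())

    outer-mv-edge⇒pendant : (X : Subset n) → IsOuterMutualVisibility G X →
                            ∀ {x y w} → X x → X y → Adj G x y → Adj G y w → w ≡ x
    outer-mv-edge⇒pendant X (inside , outside) {x} {y} {w} Xx Xy xy yw with w ≟ x
    ... | yes w≡x = w≡x
    ... | no w≢x = ⊥-elim (¬¬-excluded-middle λ
      { (yes Xw)  → ¬Visible (inside x w Xx Xw)
      ; (no ¬Xw) → ¬Visible (outside x w Xx ¬Xw)
      })
      where
      ¬Visible : ¬ Visible G X x w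
      ¬Visible = middle∈X⇒¬Visible X Xy xy yw w≢x

lemma1p1 : ∀ {n : ℕ} (G : Graph n) → 3 ≤ n → Connected G → GirthAtLeast G 5 →
    (X : Subset n) → IsOuterMutualVisibility G X → IsIndependent G X
lemma1p1 G 3≤n connected girth≥5 X omv x y Xx Xy xy
  with z , z≢x , z≢y ← third-vertex 3≤n x y
  with u , w , u∈xy , w∉xy , uw ←
         walk-exits G (λ v → v ≟ x ⊎-dec v ≟ y) (proj₂ (connected x z)) (inj₁ refl) [ z≢x , z≢y ]
  with u∈xy
... | inj₁ refl = w∉xy (inj₂ (outer-mv-edge⇒pendant G girth≥5 X omv Xy Xx (sym G xy) uw))
... | inj₂ refl = w∉xy (inj₁ (outer-mv-edge⇒pendant G girth≥5 X omv Xx Xy xy uw))
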